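{- Let $\mathcal{C}$ be a class of $\{0,1\}$-valued functions over a domain $X$ and $f\in\mathcal{C}^k$. If there exists a unique set $\{f_1,\dots,f_k\}\subseteq\mathcal{C}$ such that $f=f_1\wedge\dots\wedge f_k$, then $$ \bigcup_{i=1}^k S_\nu(f_i,\mathcal{C})\subseteq S_\nu(f,\mathcal{C}^k)\qquad(\nu=0,1). $$
   Context: $M_\nu(f)=\{x\in X: f(x)=\nu\}$. $\mathcal{C}^k$ is the class of functions that can be written as a conjunction of $k$ functions from $\mathcal{C}$. For a class $\mathcal{D}$ and $g\in\mathcal{D}$, a point $x\in X$ is essential for $g$ with respect to $\mathcal{D}$ if there is $h\in\mathcal{D}$ with $h(x)\neq g(x)$ and $h=g$ on $X\setminus\{x\}$; $S(g,\mathcal{D})$ is the set of essential points and $S_\nu(g,\mathcal{D})=S(g,\mathcal{D})\cap M_\nu(g)$. -}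

module Defs where

open import Data.Bool using (Bool; true; false; _∧_)
open import Data.Nat using (ℕ; zero; suc)
open import Data.Fin using (Fin; zero; suc)
open import Data.Product using (Σ; ∃; _×_; _,_)
open import Relation.Binary.PropositionalEquality using (_≡_; _≢_)
open import Relation.Nullary using (¬_)

Fn : Set → Set
Fn X = X → Bool

Class : Set → Set₁
Class X = Fn X → Set

_≐_ : {X : Set} → Fn X → Fn X → Set
f ≐ g = ∀ x → f x ≡ g x

conj : {X : Set} {k : ℕ} → (Fin k → Fn X) → Fn X
conj {k = zero}  gs x = true
conj {k = suc k} gs x = gs zero x ∧ conj (λ i → gs (suc i)) x

-- C^k : functions that can be written as a conjunction of k functions from C
Pow : {X : Set} → Class X → ℕ → Class X
Pow {X} C k f = Σ (Fin k → Fn X) (λ gs → (∀ i → C (gs i)) × (f ≐ conj gs))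

M : {X : Set} → Bool → Fn X → X → Set
M ν f x = f x ≡ ν

Essential : {X : Set} → Class X → Fn X → X → Set
Essential {X} D g x =
  Σ (Fn X) (λ h → D h × (h x ≢ g x) × (∀ y → y ≢ x → h y ≡ g y))

S : {X : Set} → Bool → Fn X → Class X → X → Set
S ν g D x = Essential D g x × M ν g x

SameSet : {X : Set} {k : ℕ} → (Fin k → Fn X) → (Fin k → Fn X) → Set
SameSet {k = k} fs gs =
  (∀ i → ∃ λ (j : Fin k) → fs i ≐ gs j) × (∀ j → ∃ λ (i : Fin k) → gs j ≐ fs i)

module Submission where

-- Let f = f₁ ∧ … ∧ f_k with every fᵢ ∈ C, the set {f₁,…,f_k} being the only
-- such set of factors, and let x be essential for fᵢ w.r.t. C: some h ∈ C
-- differs from fᵢ exactly at x.  Replacing fᵢ by h gives g ∈ Cᵏ, equal to f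
-- off x, and g x = h x ≠ fᵢ x = f x as soon as every other factor f_j is true
-- at x; that is the whole content of the corollary (`others-true-at`).
-- If some f_j (j ≠ i) were false at x, f would be false at x no matter what
-- the remaining factors do there.  Then one could exchange a factor a that is
-- true at x for some b ∈ C that is false at x and equals a elsewhere: putting
-- b in place of every copy of a still factorises f, but a is no longer among
-- the factors, contradicting uniqueness (`no-exchange`).

open import Defs
open import Data.Bool using (Bool; true; false; _∧_)
open import Data.Bool.Properties using (∧-identityʳ) renaming (_≟_ to _≟ᵇ_)
open import Data.Nat using (ℕ; zero; suc)
open import Data.Fin using (Fin; zero; suc; _≟_)
open import Data.Fin.Properties using (suc-injective)
open import Data.Product using (∃; _,_; proj₁; proj₂)
open import Data.Empty using (⊥; ⊥-elim)
open import Relation.Nullary using (¬_; Dec; yes; no)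
open import Relation.Nullary.Decidable.Core using (¬¬-excluded-middle; decidable-stable)
open import Relation.Binary.PropositionalEquality

-- Two Boolean functions that agree at x and off x agree everywhere.  Whether
-- y ≡ x is undecidable in general, but Boolean equations are stable under ¬¬.
agree-everywhere : {X : Set} (p q : Fn X) (x : X)
  → p x ≡ q x → (∀ y → y ≢ x → p y ≡ q y) → p ≐ q
agree-everywhere p q x at-x off-x y =
  decidable-stable (p y ≟ᵇ q y) (λ p≢q → ¬¬-excluded-middle {A = y ≡ x} λ
    { (yes refl) → p≢q at-x
    ; (no y≢x)   → p≢q (off-x y y≢x) })

¬¬-decide-all : ∀ {k} (P : Fin k → Set) → ¬ ¬ (∀ j → Dec (P j))
¬¬-decide-all {zero}  P no-decision = no-decision (λ ())
¬¬-decide-all {suc k} P no-decision = ¬¬-excluded-middle λ dec₀ →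
  ¬¬-decide-all (λ j → P (suc j)) λ decₛ →
    no-decision λ { zero → dec₀ ; (suc j) → decₛ j }

UniqueFactors : {X : Set} {k : ℕ} → Class X → Fn X → (Fin k → Fn X) → Set
UniqueFactors {X} {k} C f fs =
  ∀ (gs : Fin k → Fn X) → (∀ i → C (gs i)) → f ≐ conj gs → SameSet fs gs

module _ {X : Set} where

  conj-cong : ∀ {k} (gs fs : Fin k → Fn X) y
    → (∀ j → gs j y ≡ fs j y) → conj gs y ≡ conj fs y
  conj-cong {zero}  gs fs y same = refl
  conj-cong {suc k} gs fs y same =
    cong₂ _∧_ (same zero) (conj-cong (λ j → gs (suc j)) (λ j → fs (suc j)) y (λ j → same (suc j)))

  conj-false : ∀ {k} (gs : Fin k → Fn X) y j → gs j y ≡ false → conj gs y ≡ false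
  conj-false gs y zero    gs₀≡false rewrite gs₀≡false = refl
  conj-false gs y (suc j) gsⱼ≡false with gs zero y
  ... | false = refl
  ... | true  = conj-false (λ j → gs (suc j)) y j gsⱼ≡false

  false-factor : ∀ {k} (gs : Fin k → Fn X) y → conj gs y ≡ false → ∃ λ j → gs j y ≡ false
  false-factor {zero}  gs y ()
  false-factor {suc k} gs y conj≡false with gs zero y in gs₀y
  ... | false = zero , gs₀y
  ... | true  with false-factor (λ j → gs (suc j)) y conj≡false
  ...   | j , gsⱼ≡false = suc j , gsⱼ≡false

  conj-true : ∀ {k} (gs : Fin k → Fn X) y → (∀ j → gs j y ≡ true) → conj gs y ≡ true
  conj-true {zero}  gs y all-true = refl
  conj-true {suc k} gs y all-true rewrite all-true zero =
    conj-true (λ j → gs (suc j)) y (λ j → all-true (suc j))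

  conj-single : ∀ {k} (gs : Fin k → Fn X) y i
    → (∀ j → j ≢ i → gs j y ≡ true) → conj gs y ≡ gs i y
  conj-single {suc k} gs y zero others =
    trans (cong (gs zero y ∧_) (conj-true (λ j → gs (suc j)) y (λ j → others (suc j) (λ ()))))
          (∧-identityʳ (gs zero y))
  conj-single {suc k} gs y (suc i) others rewrite others zero (λ ()) =
    conj-single (λ j → gs (suc j)) y i (λ j j≢i → others (suc j) (λ e → j≢i (suc-injective e)))

  substitute : ∀ {k} {P : Fin k → Set} → (∀ j → Dec (P j)) → Fn X → (Fin k → Fn X) → Fin k → Fn X
  substitute P? h fs j with P? j
  ... | yes _ = h
  ... | no  _ = fs j

  substitute-hit : ∀ {k} {P : Fin k → Set} (P? : ∀ j → Dec (P j)) h fs j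
    → P j → substitute P? h fs j ≡ h
  substitute-hit P? h fs j Pj with P? j
  ... | yes _  = refl
  ... | no ¬Pj = ⊥-elim (¬Pj Pj)

  substitute-miss : ∀ {k} {P : Fin k → Set} (P? : ∀ j → Dec (P j)) h fs j
    → ¬ P j → substitute P? h fs j ≡ fs j
  substitute-miss P? h fs j ¬Pj with P? j
  ... | yes Pj = ⊥-elim (¬Pj Pj)
  ... | no  _  = refl

  substitute-∈ : ∀ {k} {P : Fin k → Set} (C : Class X) (P? : ∀ j → Dec (P j)) h fs
    → C h → (∀ j → C (fs j)) → ∀ j → C (substitute P? h fs j)
  substitute-∈ C P? h fs h∈C fs∈C j with P? j
  ... | yes _ = h∈C
  ... | no  _ = fs∈C j

  substitute-at : ∀ {k} {P : Fin k → Set} (P? : ∀ j → Dec (P j)) h fs y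
    → (∀ j → P j → h y ≡ fs j y) → ∀ j → substitute P? h fs j y ≡ fs j y
  substitute-at P? h fs y agree j with P? j
  ... | yes Pj = agree j Pj
  ... | no  _  = refl

  substitute-factorises : ∀ {k} {P : Fin k → Set} (P? : ∀ j → Dec (P j)) h fs (f : Fn X) (x : X)
    → f ≐ conj fs
    → (j : Fin k) → ¬ P j → fs j x ≡ false
    → (∀ y → y ≢ x → ∀ j → P j → h y ≡ fs j y)
    → f ≐ conj (substitute P? h fs)
  substitute-factorises P? h fs f x f≐ j ¬Pj fsⱼx≡false agree-off =
    agree-everywhere f (conj gs) x at-x off-x
    where
    gs : Fin _ → Fn X
    gs = substitute P? h fs

    at-x : f x ≡ conj gs x
    at-x = begin
      f x        ≡⟨ f≐ x ⟩
      conj fs x  ≡⟨ conj-false fs x j fsⱼx≡false ⟩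
      false      ≡⟨ sym (conj-false gs x j gsⱼx≡false) ⟩
      conj gs x  ∎
      where
      open ≡-Reasoning
      gsⱼx≡false : gs j x ≡ false
      gsⱼx≡false = trans (cong-app (substitute-miss P? h fs j ¬Pj) x) fsⱼx≡false

    off-x : ∀ y → y ≢ x → f y ≡ conj gs y
    off-x y y≢x = trans (f≐ y) (sym (conj-cong gs fs y (substitute-at P? h fs y (agree-off y y≢x))))

  replace : ∀ {k} → (Fin k → Fn X) → Fin k → Fn X → Fin k → Fn X
  replace fs i h = substitute (_≟ i) h fs

  -- Replacing every copy of fs m by b factorises f again (a kept
  -- factor is false at x), so fs m must be one of the new factors; but the new
  -- factors are b, which differs from fs m at x, and factors different from fs m.
  no-exchange : (C : Class X) {k : ℕ} (f : Fn X) (fs : Fin k → Fn X)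
    → (∀ j → C (fs j)) → f ≐ conj fs → UniqueFactors C f fs
    → (x : X) → f x ≡ false
    → (m : Fin k) (b : Fn X) → C b
    → fs m x ≡ true → b x ≡ false → (∀ y → y ≢ x → b y ≡ fs m y)
    → ⊥
  no-exchange C f fs fs∈C f≐ unique x fx≡false m b b∈C fsₘx≡true bx≡false b≐off =
    ¬¬-decide-all (λ j → fs j ≐ fs m) exchange
    where
    exchange : (∀ j → Dec (fs j ≐ fs m)) → ⊥
    exchange copy? = fs-m-missing (proj₁ (unique gs (substitute-∈ C copy? b fs b∈C fs∈C) f≐gs) m)
      where
      gs : Fin _ → Fn X
      gs = substitute copy? b fs

      not-a-copy : ∀ j → fs j x ≡ false → ¬ (fs j ≐ fs m)
      not-a-copy j fsⱼx≡false fsⱼ≐fsₘ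
        with () ← trans (sym fsₘx≡true) (trans (sym (fsⱼ≐fsₘ x)) fsⱼx≡false)

      f≐gs : f ≐ conj gs
      f≐gs with false-factor fs x (trans (sym (f≐ x)) fx≡false)
      ... | j , fsⱼx≡false =
        substitute-factorises copy? b fs f x f≐ j (not-a-copy j fsⱼx≡false) fsⱼx≡false
          (λ y y≢x l fsₗ≐fsₘ → trans (b≐off y y≢x) (sym (fsₗ≐fsₘ y)))

      fs-m-missing : (∃ λ l → fs m ≐ gs l) → ⊥
      fs-m-missing (l , fsₘ≐gsₗ) with copy? l
      ... | yes _ with () ← trans (sym fsₘx≡true) (trans (fsₘ≐gsₗ x) bx≡false)
      ... | no fsₗ≢fsₘ = fsₗ≢fsₘ (λ y → sym (fsₘ≐gsₗ y))

  -- Otherwise f x ≡ false, and the exchange lemma is violated: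
  -- directly by trading fs i for h when fs i x ≡ true; and when fs i x ≡ false,
  -- uniqueness applied to the factorisation with fs i replaced by h shows h ≐ fs m
  -- for some m, so that fs m can be traded for fs i.
  others-true-at : (C : Class X) {k : ℕ} (f : Fn X) (fs : Fin k → Fn X)
    → (∀ j → C (fs j)) → f ≐ conj fs → UniqueFactors C f fs
    → (i : Fin k) (x : X) (h : Fn X) → C h
    → h x ≢ fs i x → (∀ y → y ≢ x → h y ≡ fs i y)
    → ∀ j → j ≢ i → fs j x ≡ true
  others-true-at C f fs fs∈C f≐ unique i x h h∈C hx≢fsᵢx h≐off j j≢i with fs j x in fsⱼx
  ... | true  = refl
  ... | false = ⊥-elim (exchange-possible (trans (f≐ x) (conj-false fs x j fsⱼx)))
    where
    exchange-possible : f x ≡ false → ⊥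
    exchange-possible fx≡false with fs i x in fsᵢx | h x in hx
    ... | true  | true  = hx≢fsᵢx refl
    ... | false | false = hx≢fsᵢx refl
    ... | true  | false = no-exchange C f fs fs∈C f≐ unique x fx≡false i h h∈C fsᵢx hx h≐off
    ... | false | true  =
      no-exchange C f fs fs∈C f≐ unique x fx≡false m (fs i) (fs∈C i)
        (trans (sym (h≐fsₘ x)) hx) fsᵢx (λ y y≢x → trans (sym (h≐off y y≢x)) (h≐fsₘ y))
      where
      f≐replaced : f ≐ conj (replace fs i h)
      f≐replaced = substitute-factorises (_≟ i) h fs f x f≐ j j≢i fsⱼx
        (λ { y y≢x .i refl → h≐off y y≢x })

      h-is-a-factor : ∃ λ m → replace fs i h i ≐ fs m
      h-is-a-factor =
        proj₂ (unique (replace fs i h) (substitute-∈ C (_≟ i) h fs h∈C fs∈C) f≐replaced) i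

      m : Fin _
      m = proj₁ h-is-a-factor

      h≐fsₘ : h ≐ fs m
      h≐fsₘ y = trans (cong-app (sym (substitute-hit (_≟ i) h fs i refl)) y) (proj₂ h-is-a-factor y)

corollary1 : {X : Set} (C : Class X) (k : ℕ) (f : Fn X) (fs : Fin k → Fn X)
    → (∀ i → C (fs i))
    → f ≐ conj fs
    → (∀ (gs : Fin k → Fn X) → (∀ i → C (gs i)) → f ≐ conj gs → SameSet fs gs)
    → ∀ (ν : Bool) (i : Fin k) (x : X) → S ν (fs i) C x → S ν f (Pow C k) x
corollary1 {X} C k f fs fs∈C f≐ unique ν i x ((h , h∈C , hx≢fsᵢx , h≐off) , fsᵢx≡ν) =
  (g , (gs , substitute-∈ C (_≟ i) h fs h∈C fs∈C , λ _ → refl) , gx≢fx , g≐off)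
  , trans fx≡fsᵢx fsᵢx≡ν
  where
  gs : Fin k → Fn X
  gs = replace fs i h

  g : Fn X
  g = conj gs

  others-true : ∀ j → j ≢ i → fs j x ≡ true
  others-true = others-true-at C f fs fs∈C f≐ unique i x h h∈C hx≢fsᵢx h≐off

  fx≡fsᵢx : f x ≡ fs i x
  fx≡fsᵢx = trans (f≐ x) (conj-single fs x i others-true)

  gx≡hx : g x ≡ h x
  gx≡hx = begin
    g x     ≡⟨ conj-single gs x i others-true-in-gs ⟩
    gs i x  ≡⟨ cong-app (substitute-hit (_≟ i) h fs i refl) x ⟩
    h x     ∎
    where
    open ≡-Reasoning
    others-true-in-gs : ∀ j → j ≢ i → gs j x ≡ true
    others-true-in-gs j j≢i =
      trans (cong-app (substitute-miss (_≟ i) h fs j j≢i) x) (others-true j j≢i)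

  gx≢fx : g x ≢ f x
  gx≢fx gx≡fx = hx≢fsᵢx (trans (sym gx≡hx) (trans gx≡fx fx≡fsᵢx))

  g≐off : ∀ y → y ≢ x → g y ≡ f y
  g≐off y y≢x =
    trans (conj-cong gs fs y (substitute-at (_≟ i) h fs y (λ { .i refl → h≐off y y≢x })))
          (sym (f≐ y))
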